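{- Let $k\ge3$ be odd, $\lambda=(k-1)/2$, $N$ a positive multiple of $4$, and let $g = \sum_{n\geq 0} a(n) q^n \in M_{k/2}(\Gamma_0(N)) \cap \mathbb{Z}[[q]]$. Let $\ell,m$ be primes and $\lambda_{m,\ell}$ an integer such that $g \mid T(\ell^2) \equiv \lambda_{m,\ell}\, g \pmod{m\mathbb{Z}[[q]]}$. (a) If $\lambda_{m,\ell} \equiv 0 \pmod m$, then $a(\ell^3 n) \equiv 0 \pmod m$ for every $n$ prime to $\ell$. (b) If there exists $\epsilon \in \{\pm1\}$ such that $\lambda_{m,\ell} \equiv \epsilon\, \ell^{\frac{k-3}{2}} \pmod m$, then $a(\ell^2 n) \equiv 0 \pmod m$ for every $n$ prime to $\ell$ such that $\omega_n(\ell) = \epsilon$.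
   Context: $M_{k/2}(\Gamma_0(N))$ is the space of holomorphic modular forms of weight $k/2$ on $\Gamma_0(N)$ with trivial character. $\omega_n(\ell)=\left(\frac{(-1)^\lambda n}{\ell}\right)$ (Kronecker symbol). The Hecke operator is $g\mid T(\ell^2)=\sum_{n\ge0}\left(a(\ell^2n)+\ell^{\lambda-1}\omega_n(\ell)a(n)+\ell^{2\lambda-1}a(n/\ell^2)\right)q^n$, with $a(n/\ell^2)=0$ if $\ell^2\nmid n$. -}

module Defs where

open import Data.Nat as ℕ using (ℕ; zero; suc; _∸_)
import Data.Nat.Divisibility as ℕD
open import Data.Nat.DivMod using (_/_; _%_)
open import Data.Integer as ℤ using (ℤ; +_; -_; _-_; _*_; _+_)
open import Data.Integer.DivMod using (_%ℕ_)
import Data.Integer.Divisibility as ℤD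
open import Data.Bool using (Bool; true; false; if_then_else_)
open import Data.List using (List; upTo)
open import Data.Bool.ListAction using (any)
open import Relation.Nullary.Decidable using (⌊_⌋)

_≡_[mod_] : ℤ → ℤ → ℕ → Set
x ≡ y [mod m ] = (+ m) ℤD.∣ (x - y)

legendreOdd : ℤ → (p : ℕ) → .{{_ : ℕ.NonZero p}} → ℤ
legendreOdd a p with a %ℕ p
... | zero = + 0
... | r@(suc _) =
  if any (λ x → ⌊ ((x ℕ.* x) % p) ℕ.≟ r ⌋) (upTo p) then + 1 else - (+ 1)

kronecker2 : ℤ → ℤ
kronecker2 a with a %ℕ 8
... | 1 = + 1
... | 7 = + 1
... | 3 = - (+ 1)
... | 5 = - (+ 1)
... | _ = + 0

-- Kronecker symbol (a / ℓ) for ℓ prime (only primes are needed)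
kroneckerPrime : ℤ → ℕ → ℤ
kroneckerPrime a 0 = + 0
kroneckerPrime a 1 = + 0
kroneckerPrime a 2 = kronecker2 a
kroneckerPrime a p@(suc (suc (suc _))) = legendreOdd a p

lam : ℕ → ℕ
lam k = (k ∸ 1) / 2

ω : (k n ℓ : ℕ) → ℤ
ω k n ℓ = kroneckerPrime ((- (+ 1)) ℤ.^ lam k * (+ n)) ℓ

aDiv : (ℕ → ℤ) → ℕ → ℕ → ℤ
aDiv a ℓ n with ℓ ℕ.* ℓ
... | zero = + 0
... | d@(suc _) = if ⌊ d ℕD.∣? n ⌋ then a (n / d) else + 0

-- n-th coefficient of g | T(ℓ²), where g = Σ a(n) qⁿ has weight k/2
heckeCoeff : (k : ℕ) → (ℕ → ℤ) → (ℓ n : ℕ) → ℤ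
heckeCoeff k a ℓ n =
  a (ℓ ℕ.* ℓ ℕ.* n)
  + (+ (ℓ ℕ.^ (lam k ∸ 1))) * ω k n ℓ * a n
  + (+ (ℓ ℕ.^ (2 ℕ.* lam k ∸ 1))) * aDiv a ℓ n

-- Read the Hecke congruence at an index n with ℓ² ∤ n: the term a(n/ℓ²) drops out, leaving
--   a(ℓ²n) ≡ (λ_{m,ℓ} − ℓ^{λ−1} ω_n(ℓ)) a(n)  (mod m).
-- For (a) take the index ℓn with ℓ ∤ n, where ω_{ℓn}(ℓ) = 0 because the Kronecker symbol
-- vanishes on multiples of ℓ; for (b) take n itself, where ω_n(ℓ) = ε.  In both cases the
-- factor in front of a(·) is ≡ 0 (mod m).
module Submission where

open import Defs
open import Data.Nat using (ℕ; _≤_; _*_; _^_; _∸_)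
open import Relation.Nullary using (¬_)
open import Data.Nat.Divisibility using (_∣_)
open import Data.Nat.Primality using (Prime)
open import Data.Nat.Coprimality using (Coprime)
open import Data.Integer as ℤ using (ℤ; +_; -_)
open import Data.Product using (_×_)
open import Data.Sum using (_⊎_)
open import Relation.Binary.PropositionalEquality using (_≡_)

import Data.Nat as ℕ
import Data.Nat.Properties as ℕP
import Data.Nat.Divisibility as ℕD
import Data.Nat.Primality as ℕPr
import Data.Nat.Tactic.RingSolver as ℕSolver
import Data.Integer.Properties as ℤP
import Data.Integer.Tactic.RingSolver as ℤSolver
open import Data.Integer.Divisibility.Signed as ℤS using (∣ᵤ⇒∣; ∣⇒∣ᵤ)
open import Data.Integer.DivMod using (_%ℕ_; _/ℕ_; a≡a%ℕn+[a/ℕn]*n; n%ℕd<d)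
open import Data.Product using (_,_)
open import Relation.Nullary using (yes; no; contradiction)
open import Relation.Binary.PropositionalEquality using (refl; sym; trans; cong; subst; module ≡-Reasoning)

∣⇒∣%ℕ : ∀ {d D} .{{_ : ℕ.NonZero D}} {x} → d ∣ D → + d ℤS.∣ x → d ∣ x %ℕ D
∣⇒∣%ℕ {d} {D} {x} d∣D d∣x =
  ∣⇒∣ᵤ {i = + (x %ℕ D)} (ℤS.∣m+n∣n⇒∣m d∣r+qD (ℤS.∣n⇒∣m*n (x /ℕ D) (∣ᵤ⇒∣ {i = + D} d∣D)))
  where
  d∣r+qD : + d ℤS.∣ + (x %ℕ D) ℤ.+ (x /ℕ D) ℤ.* + D
  d∣r+qD = subst (+ d ℤS.∣_) (a≡a%ℕn+[a/ℕn]*n x D) d∣x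

legendreOdd-∣ : ∀ {x} p .{{_ : ℕ.NonZero p}} → + p ℤS.∣ x → legendreOdd x p ≡ + 0
legendreOdd-∣ {x} p p∣x with x %ℕ p | ∣⇒∣%ℕ {x = x} ℕD.∣-refl p∣x | n%ℕd<d x p
... | ℕ.zero  | _   | _     = refl
... | ℕ.suc r | p∣r | r<p = contradiction (ℕD.∣⇒≤ p∣r) (ℕP.<⇒≱ r<p)

kronecker2-even : ∀ {x} → + 2 ℤS.∣ x → kronecker2 x ≡ + 0
kronecker2-even {x} 2∣x with x %ℕ 8 | ∣⇒∣%ℕ {D = 8} {x} (ℕD.divides 4 refl) 2∣x
... | 1 | 2∣1 = contradiction (ℕD.n∣m⇒m%n≡0 1 2 2∣1) λ ()
... | 3 | 2∣3 = contradiction (ℕD.n∣m⇒m%n≡0 3 2 2∣3) λ ()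
... | 5 | 2∣5 = contradiction (ℕD.n∣m⇒m%n≡0 5 2 2∣5) λ ()
... | 7 | 2∣7 = contradiction (ℕD.n∣m⇒m%n≡0 7 2 2∣7) λ ()
... | 0 | _ = refl
... | 2 | _ = refl
... | 4 | _ = refl
... | 6 | _ = refl
... | ℕ.suc (ℕ.suc (ℕ.suc (ℕ.suc (ℕ.suc (ℕ.suc (ℕ.suc (ℕ.suc _))))))) | _ = refl

kroneckerPrime-∣ : ∀ {x p} → Prime p → + p ℤS.∣ x → kroneckerPrime x p ≡ + 0
kroneckerPrime-∣ {p = 0} p-prime _ = contradiction p-prime ℕPr.¬prime[0]
kroneckerPrime-∣ {p = 1} p-prime _ = contradiction p-prime ℕPr.¬prime[1]
kroneckerPrime-∣ {p = 2} _ 2∣x = kronecker2-even 2∣x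
kroneckerPrime-∣ {p = p@(ℕ.suc (ℕ.suc (ℕ.suc _)))} _ p∣x = legendreOdd-∣ p p∣x

ω-multiple : ∀ k n {ℓ} → Prime ℓ → ω k (ℓ * n) ℓ ≡ + 0
ω-multiple k n ℓ-prime =
  kroneckerPrime-∣ ℓ-prime (ℤS.∣n⇒∣m*n ((- + 1) ℤ.^ lam k) (∣ᵤ⇒∣ (ℕD.m∣m*n n)))

aDiv-∤ : ∀ a ℓ {n} → ¬ (ℓ * ℓ ∣ n) → aDiv a ℓ n ≡ + 0
aDiv-∤ a ℓ {n} ℓ²∤n with ℓ * ℓ
... | ℕ.zero = refl
... | d@(ℕ.suc _) with d ℕD.∣? n
...   | yes d∣n = contradiction d∣n ℓ²∤n
...   | no _    = refl

coprime⇒∤ : ∀ {p n} → Prime p → Coprime n p → ¬ (p ∣ n)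
coprime⇒∤ p-prime coprime p∣n =
  ℕPr.¬prime[1] (subst Prime (coprime (p∣n , ℕD.∣-refl)) p-prime)

coprime⇒p*p∤n : ∀ {p n} → Prime p → Coprime n p → ¬ (p * p ∣ n)
coprime⇒p*p∤n {p} p-prime coprime p²∣n =
  coprime⇒∤ p-prime coprime (ℕD.∣-trans (ℕD.m∣m*n p) p²∣n)

coprime⇒p*p∤p*n : ∀ {p n} → Prime p → Coprime n p → ¬ (p * p ∣ p * n)
coprime⇒p*p∤p*n {p} p-prime coprime p²∣pn =
  coprime⇒∤ p-prime coprime (ℕD.*-cancelˡ-∣ p {{ℕPr.prime⇒nonZero p-prime}} p²∣pn)

ℓ^3*n≡ℓ*ℓ*[ℓ*n] : ∀ ℓ n → ℓ ^ 3 * n ≡ ℓ * ℓ * (ℓ * n)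
ℓ^3*n≡ℓ*ℓ*[ℓ*n] = unfolded
  where
  unfolded : ∀ ℓ n → ℓ * (ℓ * (ℓ * 1)) * n ≡ ℓ * ℓ * (ℓ * n)
  unfolded = ℕSolver.solve-∀

ℓ^2*n≡ℓ*ℓ*n : ∀ ℓ n → ℓ ^ 2 * n ≡ ℓ * ℓ * n
ℓ^2*n≡ℓ*ℓ*n = unfolded
  where
  unfolded : ∀ ℓ n → ℓ * (ℓ * 1) * n ≡ ℓ * ℓ * n
  unfolded = ℕSolver.solve-∀

hecke⇒a[ℓ*ℓ*n]≡0 : ∀ k a ℓ m c n → ¬ (ℓ * ℓ ∣ n) →
  heckeCoeff k a ℓ n ≡ c ℤ.* a n [mod m ] →
  c ≡ + (ℓ ^ (lam k ∸ 1)) ℤ.* ω k n ℓ [mod m ] →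
  a (ℓ * ℓ * n) ≡ + 0 [mod m ]
hecke⇒a[ℓ*ℓ*n]≡0 k a ℓ m c n ℓ²∤n hecke c≡Lω =
  ∣⇒∣ᵤ (subst (+ m ℤS.∣_) split (ℤS.∣m∣n⇒∣m+n m∣hecke (ℤS.∣m⇒∣m*n (a n) m∣c-Lω)))
  where
  L = + (ℓ ^ (lam k ∸ 1))
  C = + (ℓ ^ (2 ℕ.* lam k ∸ 1))
  m∣hecke : + m ℤS.∣ heckeCoeff k a ℓ n ℤ.- c ℤ.* a n
  m∣hecke = ∣ᵤ⇒∣ hecke
  m∣c-Lω : + m ℤS.∣ c ℤ.- L ℤ.* ω k n ℓ
  m∣c-Lω = ∣ᵤ⇒∣ c≡Lω
  split : heckeCoeff k a ℓ n ℤ.- c ℤ.* a n ℤ.+ (c ℤ.- L ℤ.* ω k n ℓ) ℤ.* a n ≡ a (ℓ * ℓ * n) ℤ.- + 0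
  split = begin
    heckeCoeff k a ℓ n ℤ.- c ℤ.* a n ℤ.+ (c ℤ.- L ℤ.* ω k n ℓ) ℤ.* a n
      ≡⟨ cong (λ t → a (ℓ * ℓ * n) ℤ.+ L ℤ.* ω k n ℓ ℤ.* a n ℤ.+ C ℤ.* t ℤ.- c ℤ.* a n
                       ℤ.+ (c ℤ.- L ℤ.* ω k n ℓ) ℤ.* a n)
              (aDiv-∤ a ℓ ℓ²∤n) ⟩
    a (ℓ * ℓ * n) ℤ.+ L ℤ.* ω k n ℓ ℤ.* a n ℤ.+ C ℤ.* + 0 ℤ.- c ℤ.* a n
      ℤ.+ (c ℤ.- L ℤ.* ω k n ℓ) ℤ.* a n
      ≡⟨ rearrange (a (ℓ * ℓ * n)) L (ω k n ℓ) C c (a n) ⟩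
    a (ℓ * ℓ * n) ℤ.- + 0 ∎
    where
    open ≡-Reasoning
    rearrange : ∀ A L w C c x →
      A ℤ.+ L ℤ.* w ℤ.* x ℤ.+ C ℤ.* + 0 ℤ.- c ℤ.* x ℤ.+ (c ℤ.- L ℤ.* w) ℤ.* x ≡ A ℤ.- + 0
    rearrange = ℤSolver.solve-∀

proposition4p1 : (IsModularForm : ℕ → ℕ → (ℕ → ℤ) → Set) →
    (k N : ℕ) → 3 ≤ k → ¬ (2 ∣ k) → 1 ≤ N → 4 ∣ N →
    (a : ℕ → ℤ) → IsModularForm k N a →
    (ℓ m : ℕ) → Prime ℓ → Prime m → (λmℓ : ℤ) →
    ((n : ℕ) → heckeCoeff k a ℓ n ≡ λmℓ ℤ.* a n [mod m ]) →
    ((λmℓ ≡ + 0 [mod m ]) →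
    (n : ℕ) → Coprime n ℓ → a (ℓ ^ 3 * n) ≡ + 0 [mod m ])
    ×
    ((ε : ℤ) → (ε ≡ + 1 ⊎ ε ≡ - (+ 1)) →
    (λmℓ ≡ ε ℤ.* (+ (ℓ ^ (lam k ∸ 1))) [mod m ]) →
    (n : ℕ) → Coprime n ℓ → ω k n ℓ ≡ ε →
    a (ℓ ^ 2 * n) ≡ + 0 [mod m ])
proposition4p1 _ k _ _ _ _ _ a _ ℓ m ℓ-prime _ λmℓ hecke = part-a , part-b
  where
  L = + (ℓ ^ (lam k ∸ 1))

  part-a : λmℓ ≡ + 0 [mod m ] → (n : ℕ) → Coprime n ℓ → a (ℓ ^ 3 * n) ≡ + 0 [mod m ]
  part-a λ≡0 n coprime =
    subst (λ i → a i ≡ + 0 [mod m ]) (sym (ℓ^3*n≡ℓ*ℓ*[ℓ*n] ℓ n))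
      (hecke⇒a[ℓ*ℓ*n]≡0 k a ℓ m λmℓ (ℓ * n) (coprime⇒p*p∤p*n ℓ-prime coprime) (hecke (ℓ * n)) λ≡Lω)
    where
    Lω≡0 : L ℤ.* ω k (ℓ * n) ℓ ≡ + 0
    Lω≡0 = trans (cong (L ℤ.*_) (ω-multiple k n ℓ-prime)) (ℤP.*-zeroʳ L)
    λ≡Lω : λmℓ ≡ L ℤ.* ω k (ℓ * n) ℓ [mod m ]
    λ≡Lω = subst (λ t → λmℓ ≡ t [mod m ]) (sym Lω≡0) λ≡0

  part-b : (ε : ℤ) → (ε ≡ + 1 ⊎ ε ≡ - (+ 1)) → λmℓ ≡ ε ℤ.* L [mod m ] →
    (n : ℕ) → Coprime n ℓ → ω k n ℓ ≡ ε → a (ℓ ^ 2 * n) ≡ + 0 [mod m ]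
  part-b ε _ λ≡εL n coprime ω≡ε =
    subst (λ i → a i ≡ + 0 [mod m ]) (sym (ℓ^2*n≡ℓ*ℓ*n ℓ n))
      (hecke⇒a[ℓ*ℓ*n]≡0 k a ℓ m λmℓ n (coprime⇒p*p∤n ℓ-prime coprime) (hecke n) λ≡Lω)
    where
    εL≡Lω : ε ℤ.* L ≡ L ℤ.* ω k n ℓ
    εL≡Lω = trans (ℤP.*-comm ε L) (cong (L ℤ.*_) (sym ω≡ε))
    λ≡Lω : λmℓ ≡ L ℤ.* ω k n ℓ [mod m ]
    λ≡Lω = subst (λ t → λmℓ ≡ t [mod m ]) εL≡Lω λ≡εL
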